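{- Let $\lambda/\mu$ be a horizontal strip (with $\lambda\vdash n$) all of whose cells lie in the same row, and let $k\ge0$. Then $\mathcal{E}_{\lambda/\mu}(k)$, as a polynomial in $q$, is palindromic (its sequence of coefficients reads the same forward and backward) and unimodal (its coefficients first weakly increase and then weakly decrease).
   Context: $q$ is an indeterminate; $[a]_q=(1-q^a)/(1-q)$. Young diagrams in English notation; cell $(r,s)$ has content $s-r$. For $\mu\subseteq\lambda$, $\lambda/\mu$ is the set of cells of $\lambda$ not in $\mu$; it is a horizontal strip if no two of its cells share a column. For $\lambda\vdash n$, $\mu\vdash j$, fill the cells of $\lambda/\mu$ with $j+1,\dots,n$, rows top to bottom, each row left to right; let $c_\ell$ be the content of the cell containing $\ell$, and $$\mathcal{E}_{\lambda/\mu}(k)=q^{nk-\binom k2}\sum_{j<\ell_1<\cdots<\ell_k\le n}\prod_{m=1}^kq^{ -\ell_m}[\ell_m+1-m+c_{\ell_m}]_q ,$$ which is a polynomial in $q$. -}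

module Defs where

open import Data.Nat as ℕ using (ℕ; zero; suc; _∸_)
open import Data.Nat.Combinatorics using (_C_)
open import Data.Integer as ℤ using (ℤ; +_; -[1+_]; _+_; _-_; _*_; -_; _≤_; _<_)
open import Data.List using (List; []; _∷_; map; concatMap; upTo; _++_; filter)
open import Data.Nat.ListAction using (sum)
open import Data.List.Relation.Unary.All using (All)
open import Data.List.Relation.Unary.Linked using (Linked)
open import Data.Product using (_×_; _,_; Σ; proj₁)
open import Data.Sum using (_⊎_)
open import Relation.Binary.PropositionalEquality using (_≡_; _≢_)
open import Relation.Nullary using (¬_)
open import Data.Integer using (_≟_)
open import Relation.Nullary.Decidable using (does)
open import Data.Bool using (if_then_else_)

IsPartition : List ℕ → Set
IsPartition xs = All (λ x → 0 ℕ.< x) xs × Linked ℕ._≥_ xs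

-- i-th part (0-based), zero beyond the length
part : List ℕ → ℕ → ℕ
part []       _       = 0
part (x ∷ _)  zero    = x
part (_ ∷ xs) (suc i) = part xs i

_⊆ₚ_ : List ℕ → List ℕ → Set
μ ⊆ₚ λ′ = ∀ i → part μ i ℕ.≤ part λ′ i

-- λ/μ is a horizontal strip: no two cells in the same column,
-- i.e. λ_{i+1} ≤ μ_i for all rows i
HorizontalStrip : List ℕ → List ℕ → Set
HorizontalStrip λ′ μ = ∀ i → part λ′ (suc i) ℕ.≤ part μ i

SingleRow : List ℕ → List ℕ → Set
SingleRow λ′ μ = Σ ℕ λ r → ∀ i → i ≢ r → part μ i ≡ part λ′ i

-- Contents of the cells of λ/μ, in reading order
-- (rows top to bottom, each row left to right).
-- Rows and columns 0-based here; content = column - row is unchanged.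

rowContents : ℕ → ℕ → ℕ → List ℤ
rowContents r a b = map (λ t → + (a ℕ.+ t) - + r) (upTo (b ∸ a))

skewContentsFrom : ℕ → List ℕ → List ℕ → List ℤ
skewContentsFrom r []        _        = []
skewContentsFrom r (l ∷ ls) []        = rowContents r 0 l ++ skewContentsFrom (suc r) ls []
skewContentsFrom r (l ∷ ls) (m ∷ ms)  = rowContents r m l ++ skewContentsFrom (suc r) ls ms

skewContents : List ℕ → List ℕ → List ℤ
skewContents = skewContentsFrom 0

label : ℕ → List ℤ → List (ℕ × ℤ)
label s []       = []
label s (c ∷ cs) = (s , c) ∷ label (suc s) cs

-- Laurent polynomials in q with integer coefficients,
-- as (unnormalised) finite lists of terms (exponent , coefficient).

LPoly : Set
LPoly = List (ℤ × ℤ)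

mono : ℤ → ℤ → LPoly
mono e c = (e , c) ∷ []

_⊗_ : LPoly → LPoly → LPoly
p ⊗ r = concatMap (λ { (e , c) → map (λ { (e′ , c′) → (e + e′ , c * c′) }) r }) p

coeff : LPoly → ℤ → ℤ
coeff []              i = + 0
coeff ((e , c) ∷ ts)  i = if does (e ≟ i) then c + coeff ts i else coeff ts i

-- [a]_q = (1 - q^a)/(1 - q) for a ∈ ℤ:
--   a = n ≥ 0      : 1 + q + … + q^(n-1)
--   a = -(b+1) < 0 : -(q^(-(b+1)) + … + q^(-1))
qint : ℤ → LPoly
qint (+ n)      = map (λ i → (+ i , + 1)) (upTo n)
qint -[1+ b ]   = map (λ i → (- (+ (suc i)) , - (+ 1))) (upTo (suc b))

choose : {A : Set} → ℕ → List A → List (List A)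
choose zero    _        = [] ∷ []
choose (suc k) []       = []
choose (suc k) (x ∷ xs) = map (x ∷_) (choose k xs) ++ choose (suc k) xs

termProd : ℕ → List (ℕ × ℤ) → LPoly
termProd m []             = mono (+ 0) (+ 1)
termProd m ((ℓ , c) ∷ xs) =
  (mono (- (+ ℓ)) (+ 1) ⊗ qint (+ ℓ + + 1 - + m + c)) ⊗ termProd (suc m) xs

𝓔 : List ℕ → List ℕ → ℕ → LPoly
𝓔 λ′ μ k =
  mono (+ (n ℕ.* k) - + (k C 2)) (+ 1)
    ⊗ concatMap (termProd 1) (choose k cells)
  where
    n = sum λ′
    j = sum μ
    cells = label (suc j) (skewContents λ′ μ)

IsPolyOfDegree : (ℤ → ℤ) → ℕ → Set
IsPolyOfDegree c d =
  c (+ d) ≢ + 0 × (∀ i → (i < + 0 ⊎ + d < i) → c i ≡ + 0)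

IsZero : (ℤ → ℤ) → Set
IsZero c = ∀ i → c i ≡ + 0

Palindromic : (ℤ → ℤ) → Set
Palindromic c = IsZero c ⊎
  Σ ℕ λ d → IsPolyOfDegree c d × (∀ i → c i ≡ c (+ d - i))

Unimodal : (ℤ → ℤ) → Set
Unimodal c = IsZero c ⊎
  Σ ℕ λ d → IsPolyOfDegree c d × Σ ℕ λ m → m ℕ.≤ d ×
    (∀ (i : ℕ) → i ℕ.< m → c (+ i) ≤ c (+ suc i)) ×
    (∀ (i : ℕ) → m ℕ.≤ i → i ℕ.< d → c (+ suc i) ≤ c (+ i))

{-# OPTIONS --safe #-}
-- In a single row the cell labelled ℓ has content ℓ + κ for a fixed κ, so the factor
-- q^{-ℓ}[ℓ+1-m+c]_q chosen at position m has exponents symmetric about (κ - m)/2, whichever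
-- cell it is. Multiplying a nonnegative symmetric unimodal sequence by a q-integer (a window
-- sum) keeps it symmetric and unimodal, and adding such sequences with a common centre does
-- too; hence so is the sum over all k-subsets of the row. The lowest exponent comes only from
-- the k largest labels and is cancelled by the prefactor q^{nk - C(k,2)}, so the result starts
-- at q^0 with a positive coefficient.
module Submission where

open import Defs
open import Data.Bool using (if_then_else_)
open import Data.Integer as ℤ using (ℤ; +_; _+_; _-_; _*_; -_; _≤_; _<_; _≟_; +≤+; +<+)
open import Data.Integer.Properties
open import Data.Integer.Tactic.RingSolver using (solve; solve-∀)
open import Algebra.Properties.CommutativeSemigroup +-commutativeSemigroup using (interchange)
open import Data.List using (List; []; _∷_; _++_; map; upTo; applyUpTo; concatMap; length; drop)
open import Data.Nat.ListAction using (sum)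
open import Data.List.Properties using (upTo-∷ʳ; map-++; concatMap-++; map-upTo; ++-identityʳ)
open import Data.List.Relation.Unary.Linked as Linked using (Linked)
open import Data.Nat as ℕ using (ℕ; zero; suc; _∸_; ⌊_/2⌋; ⌈_/2⌉)
import Data.Nat.Properties as ℕ
import Algebra.Properties.CommutativeSemigroup ℕ.+-commutativeSemigroup as ℕ-+
open import Data.Nat.Combinatorics using (_C_; nC1≡n; nCk+nC[k+1]≡[n+1]C[k+1])
open import Data.Sum using (inj₁; inj₂)
open import Data.Product using (_×_; _,_; proj₁; proj₂)
import Data.Product as Product
open import Function using (_∘_)
open import Relation.Binary.PropositionalEquality
open import Relation.Nullary using (yes; no; ¬_; contradiction)
open import Relation.Nullary.Decidable using (does)

δ : ℤ → ℤ
δ i = if does (i ≟ + 0) then + 1 else + 0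

δ-≢0 : ∀ i → i ≢ + 0 → δ i ≡ + 0
δ-≢0 i i≢0 with i ≟ + 0
... | yes i≡0 = contradiction i≡0 i≢0
... | no _ = refl

infixr 7 _⋆_

-- p ⋆ f is the coefficient sequence of p times the series with coefficients f.
_⋆_ : LPoly → (ℤ → ℤ) → ℤ → ℤ
([] ⋆ f) i = + 0
(((e , c) ∷ p) ⋆ f) i = c * f (i - e) + (p ⋆ f) i

⋆-cong : ∀ p {f g} → f ≗ g → p ⋆ f ≗ p ⋆ g
⋆-cong [] f≗g i = refl
⋆-cong ((e , c) ∷ p) f≗g i = cong₂ _+_ (cong (c *_) (f≗g (i - e))) (⋆-cong p f≗g i)

⋆-zero : ∀ p → p ⋆ (λ _ → + 0) ≗ λ _ → + 0
⋆-zero [] i = refl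
⋆-zero ((e , c) ∷ p) i = cong₂ _+_ (*-zeroʳ c) (⋆-zero p i)

⋆-+ : ∀ p f g → p ⋆ (λ i → f i + g i) ≗ λ i → (p ⋆ f) i + (p ⋆ g) i
⋆-+ [] f g i = refl
⋆-+ ((e , c) ∷ p) f g i = begin
  c * (x + y) + (p ⋆ (λ i → f i + g i)) i  ≡⟨ cong (λ z → c * (x + y) + z) (⋆-+ p f g i) ⟩
  c * (x + y) + (u + v)                    ≡⟨ cong (_+ (u + v)) (*-distribˡ-+ c x y) ⟩
  c * x + c * y + (u + v)                  ≡⟨ interchange (c * x) (c * y) u v ⟩
  c * x + u + (c * y + v)                  ∎
  where
    open ≡-Reasoning
    x = f (i - e)
    y = g (i - e)
    u = (p ⋆ f) i
    v = (p ⋆ g) i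

++-⋆ : ∀ p r f → (p ++ r) ⋆ f ≗ λ i → (p ⋆ f) i + (r ⋆ f) i
++-⋆ [] r f i = sym (+-identityˡ _)
++-⋆ ((e , c) ∷ p) r f i =
  trans (cong (λ z → c * f (i - e) + z) (++-⋆ p r f i)) (sym (+-assoc (c * f (i - e)) _ _))

-- Stated for any g acting like this, so that it applies to the anonymous function inside _⊗_.
map-scale-⋆ : ∀ e c (g : ℤ × ℤ → ℤ × ℤ) → (∀ e′ c′ → g (e′ , c′) ≡ (e + e′ , c * c′)) →
  ∀ r f i → (map g r ⋆ f) i ≡ c * (r ⋆ f) (i - e)
map-scale-⋆ e c g g-spec [] f i = sym (*-zeroʳ c)
map-scale-⋆ e c g g-spec ((e′ , c′) ∷ r) f i rewrite g-spec e′ c′ = begin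
  c * c′ * f (i - (e + e′)) + (map g r ⋆ f) i  ≡⟨ cong₂ _+_ (cong (λ j → c * c′ * f j) (solve (i ∷ e ∷ e′ ∷ [])))
                                                               (map-scale-⋆ e c g g-spec r f i) ⟩
  c * c′ * x + c * y                           ≡⟨ cong (_+ c * y) (*-assoc c c′ x) ⟩
  c * (c′ * x) + c * y                         ≡⟨ *-distribˡ-+ c (c′ * x) y ⟨
  c * (c′ * x + y)                             ∎
  where
    open ≡-Reasoning
    x = f (i - e - e′)
    y = (r ⋆ f) (i - e)

⊗-⋆ : ∀ p r f → (p ⊗ r) ⋆ f ≗ p ⋆ (r ⋆ f)
⊗-⋆ [] r f i = refl
⊗-⋆ ((e , c) ∷ p) r f i =
  trans (++-⋆ (map _ r) (p ⊗ r) f i)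
        (cong₂ _+_ (map-scale-⋆ e c _ (λ _ _ → refl) r f i) (⊗-⋆ p r f i))

coeff≗⋆δ : ∀ p → coeff p ≗ p ⋆ δ
coeff≗⋆δ [] i = refl
coeff≗⋆δ ((e , c) ∷ p) i with e ≟ i
... | yes refl rewrite +-inverseʳ e | *-identityʳ c = cong (λ z → c + z) (coeff≗⋆δ p e)
... | no e≢i rewrite δ-≢0 (i - e) (λ i-e≡0 → e≢i (sym (i-j≡0⇒i≡j i e i-e≡0))) | *-zeroʳ c =
  trans (coeff≗⋆δ p i) (sym (+-identityˡ _))

coeff-⊗ : ∀ p r → coeff (p ⊗ r) ≗ p ⋆ coeff r
coeff-⊗ p r i = trans (coeff≗⋆δ (p ⊗ r) i) (trans (⊗-⋆ p r δ i) (sym (⋆-cong p (coeff≗⋆δ r) i)))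

coeff-++ : ∀ p r → coeff (p ++ r) ≗ λ i → coeff p i + coeff r i
coeff-++ p r i = trans (coeff≗⋆δ (p ++ r) i)
  (trans (++-⋆ p r δ i) (sym (cong₂ _+_ (coeff≗⋆δ p i) (coeff≗⋆δ r i))))

mono-⋆ : ∀ e c f i → (mono e c ⋆ f) i ≡ c * f (i - e)
mono-⋆ e c f i = +-identityʳ _

window : ℕ → (ℤ → ℤ) → ℤ → ℤ
window zero    f i = + 0
window (suc x) f i = window x f i + f (i - + x)

qint-⋆ : ∀ n f → qint (+ n) ⋆ f ≗ window n f
qint-⋆ zero f i = refl
qint-⋆ (suc n) f i = begin
  (map g (upTo (suc n)) ⋆ f) i                   ≡⟨ cong (λ xs → (map g xs ⋆ f) i) (upTo-∷ʳ n) ⟨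
  (map g (upTo n ++ n ∷ []) ⋆ f) i               ≡⟨ cong (λ xs → (xs ⋆ f) i) (map-++ g (upTo n) (n ∷ [])) ⟩
  ((map g (upTo n) ++ g n ∷ []) ⋆ f) i           ≡⟨ ++-⋆ (map g (upTo n)) (g n ∷ []) f i ⟩
  (qint (+ n) ⋆ f) i + (mono (+ n) (+ 1) ⋆ f) i  ≡⟨ cong₂ _+_ (qint-⋆ n f i) (trans (mono-⋆ (+ n) (+ 1) f i) (*-identityˡ _)) ⟩
  window (suc n) f i                             ∎
  where
    open ≡-Reasoning
    g : ℕ → ℤ × ℤ
    g k = (+ k , + 1)

window-unfoldˡ : ∀ x f i → window (suc x) f i ≡ f i + window x f (i - + 1)
window-unfoldˡ zero    f i = trans (+-identityˡ _) (trans (cong f (+-identityʳ i)) (sym (+-identityʳ _)))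
window-unfoldˡ (suc x) f i = begin
  window (suc x) f i + f (i - + suc x)              ≡⟨ cong (_+ f (i - + suc x)) (window-unfoldˡ x f i) ⟩
  f i + window x f (i - + 1) + f (i - + suc x)      ≡⟨ +-assoc (f i) _ _ ⟩
  f i + (window x f (i - + 1) + f (i - + suc x))    ≡⟨ cong (λ j → f i + (window x f (i - + 1) + f j)) (step i (+ x)) ⟩
  f i + window (suc x) f (i - + 1)                  ∎
  where
    open ≡-Reasoning
    step : ∀ i x → i - (+ 1 + x) ≡ i - + 1 - x
    step = solve-∀

window-nonnegative : ∀ {f} → (∀ i → + 0 ≤ f i) → ∀ x i → + 0 ≤ window x f i
window-nonnegative f≥0 zero    i = ≤-refl
window-nonnegative f≥0 (suc x) i = +-mono-≤ (window-nonnegative f≥0 x i) (f≥0 (i - + x))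

≤-window : ∀ {f} → (∀ i → + 0 ≤ f i) → ∀ x i → f i ≤ window (suc x) f i
≤-window {f} f≥0 x i = begin
  f i                         ≡⟨ +-identityʳ (f i) ⟨
  f i + + 0                   ≤⟨ +-monoʳ-≤ (f i) (window-nonnegative f≥0 x (i - + 1)) ⟩
  f i + window x f (i - + 1)  ≡⟨ window-unfoldˡ x f i ⟨
  window (suc x) f i          ∎
  where open ≤-Reasoning

window-vanishing : ∀ {f L} → (∀ i → i < L → f i ≡ + 0) → ∀ x i → i < L → window x f i ≡ + 0
window-vanishing f<L≡0 zero    i i<L = refl
window-vanishing f<L≡0 (suc x) i i<L =
  cong₂ _+_ (window-vanishing f<L≡0 x i i<L) (f<L≡0 (i - + x) (≤-<-trans (i-j≤i i (+ x)) i<L))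

window-symmetric : ∀ {D f} → (∀ i → f i ≡ f (D - i)) → ∀ x i → window x f (D + + x - + 1 - i) ≡ window x f i
window-symmetric         f-sym zero    i = refl
window-symmetric {D} {f} f-sym (suc x) i = begin
  window x f (D + + suc x - + 1 - i) + f (D + + suc x - + 1 - i - + x)
    ≡⟨ cong₂ (λ j k → window x f j + f k) (inner D (+ x) i) (outer D (+ x) i) ⟩
  window x f (D + + x - + 1 - (i - + 1)) + f (D - i)
    ≡⟨ cong₂ _+_ (window-symmetric {D} f-sym x (i - + 1)) (sym (f-sym i)) ⟩
  window x f (i - + 1) + f i
    ≡⟨ +-comm _ (f i) ⟩
  f i + window x f (i - + 1)
    ≡⟨ window-unfoldˡ x f i ⟨
  window (suc x) f i ∎
  where
    open ≡-Reasoning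
    inner : ∀ D x i → D + (+ 1 + x) - + 1 - i ≡ D + x - + 1 - (i - + 1)
    inner = solve-∀
    outer : ∀ D x i → D + (+ 1 + x) - + 1 - i - x ≡ D - i
    outer = solve-∀

-- Symmetric unimodal sequences

-- D is twice the centre of symmetry and L a lower bound for the support.
record SymUnimodal (D L : ℤ) (f : ℤ → ℤ) : Set where
  field
    symmetric   : ∀ i → f i ≡ f (D - i)
    nonnegative : ∀ i → + 0 ≤ f i
    ascending   : ∀ i → i + i + + 1 ≤ D → f i ≤ f (i + + 1)
    vanishing   : ∀ i → i < L → f i ≡ + 0

open SymUnimodal

SymUnimodal-resp : ∀ {D L f g} → f ≗ g → SymUnimodal D L f → SymUnimodal D L g
SymUnimodal-resp f≗g S = record
  { symmetric   = λ i → trans (sym (f≗g i)) (trans (symmetric S i) (f≗g _))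
  ; nonnegative = λ i → subst (+ 0 ≤_) (f≗g i) (nonnegative S i)
  ; ascending   = λ i h → subst₂ _≤_ (f≗g i) (f≗g _) (ascending S i h)
  ; vanishing   = λ i i<L → trans (sym (f≗g i)) (vanishing S i i<L)
  }

SymUnimodal-weaken : ∀ {D L L′ f} → L′ ≤ L → SymUnimodal D L f → SymUnimodal D L′ f
SymUnimodal-weaken L′≤L S = record
  { symmetric   = symmetric S
  ; nonnegative = nonnegative S
  ; ascending   = ascending S
  ; vanishing   = λ i i<L′ → vanishing S i (<-≤-trans i<L′ L′≤L)
  }

SymUnimodal-+ : ∀ {D L f g} → SymUnimodal D L f → SymUnimodal D L g → SymUnimodal D L (λ i → f i + g i)
SymUnimodal-+ F G = record
  { symmetric   = λ i → cong₂ _+_ (symmetric F i) (symmetric G i)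
  ; nonnegative = λ i → +-mono-≤ (nonnegative F i) (nonnegative G i)
  ; ascending   = λ i h → +-mono-≤ (ascending F i h) (ascending G i h)
  ; vanishing   = λ i i<L → cong₂ _+_ (vanishing F i i<L) (vanishing G i i<L)
  }

SymUnimodal-+-positive : ∀ {D L f g} → SymUnimodal D L f → SymUnimodal D L g × + 0 < g L →
  SymUnimodal D L (λ i → f i + g i) × + 0 < f L + g L
SymUnimodal-+-positive {L = L} {f} {g} F (G , gL>0) =
  SymUnimodal-+ F G , <-≤-trans gL>0 (subst (_≤ f L + g L) (+-identityˡ (g L)) (+-monoˡ-≤ (g L) (nonnegative F L)))

SymUnimodal-δ : SymUnimodal (+ 0) (+ 0) δ
SymUnimodal-δ = record
  { symmetric   = δ-symmetric
  ; nonnegative = δ-nonnegative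
  ; ascending   = λ i h → subst (_≤ δ (i + + 1)) (sym (δ-≢0 i (λ { refl → 1≰0 h }))) (δ-nonnegative (i + + 1))
  ; vanishing   = λ i i<0 → δ-≢0 i (λ { refl → <-irrefl refl i<0 })
  }
  where
    1≰0 : ¬ (+ 1 ≤ + 0)
    1≰0 (+≤+ ())
    δ-nonnegative : ∀ i → + 0 ≤ δ i
    δ-nonnegative i with i ≟ + 0
    ... | yes _ = +≤+ ℕ.z≤n
    ... | no  _ = ≤-refl
    δ-symmetric : ∀ i → δ i ≡ δ (+ 0 - i)
    δ-symmetric i with i ≟ + 0
    ... | yes refl = refl
    ... | no  i≢0  = sym (δ-≢0 (+ 0 - i) (λ -i≡0 → i≢0 (sym (i-j≡0⇒i≡j (+ 0) i -i≡0))))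

SymUnimodal-shift : ∀ {D L f} e → SymUnimodal D L f → SymUnimodal (D + e + e) (L + e) (λ i → f (i - e))
SymUnimodal-shift {D} {L} {f} e S = record
  { symmetric   = λ i → trans (symmetric S (i - e)) (cong f (reflect D e i))
  ; nonnegative = λ i → nonnegative S (i - e)
  ; ascending   = λ i h → subst (f (i - e) ≤_) (cong f (step e i))
      (ascending S (i - e) (subst₂ _≤_ (lhs e i) (rhs D e) (+-monoˡ-≤ (- (e + e)) h)))
  ; vanishing   = λ i i<L+e → vanishing S (i - e) (subst (i - e <_) (+-cancel L e) (+-monoˡ-< (- e) i<L+e))
  }
  where
    reflect : ∀ D e i → D - (i - e) ≡ D + e + e - i - e
    reflect = solve-∀
    step : ∀ e i → i - e + + 1 ≡ i + + 1 - e
    step = solve-∀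
    lhs : ∀ e i → i + i + + 1 - (e + e) ≡ i - e + (i - e) + + 1
    lhs = solve-∀
    rhs : ∀ D e → D + e + e - (e + e) ≡ D
    rhs = solve-∀
    +-cancel : ∀ L e → L + e - e ≡ L
    +-cancel = solve-∀

-- Climb step by step while strictly below the centre; at the mirror point use symmetry.
SymUnimodal-ascending-by : ∀ {D L f} → SymUnimodal D L f →
  ∀ w a → a + (a + + w) ≤ D → f a ≤ f (a + + w)
SymUnimodal-ascending-by {f = f} S zero a _ = ≤-reflexive (cong f (sym (+-identityʳ a)))
SymUnimodal-ascending-by {D} {f = f} S (suc w) a h with a + (a + + suc w) ≟ D
... | yes meets = ≤-reflexive (trans (symmetric S a) (cong f (trans (cong (_- a) (sym meets)) (mirror a (+ w)))))
  where
    mirror : ∀ a w → a + (a + (+ 1 + w)) - a ≡ a + (+ 1 + w)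
    mirror = solve-∀
... | no  misses = ≤-trans (ascending S a first) (subst (f (a + + 1) ≤_) (cong f (regroup a (+ w))) rest)
  where
    below : + 1 + (a + (a + + suc w)) ≤ D
    below = i<j⇒suc[i]≤j (≤∧≢⇒< h misses)
    first : a + a + + 1 ≤ D
    first = ≤-trans (subst (a + a + + 1 ≤_) (drop-tail a (+ w)) (i≤i+j _ (+ suc w))) below
      where
        drop-tail : ∀ a w → a + a + + 1 + (+ 1 + w) ≡ + 1 + (a + (a + (+ 1 + w)))
        drop-tail = solve-∀
    rest : f (a + + 1) ≤ f (a + + 1 + + w)
    rest = SymUnimodal-ascending-by S w (a + + 1) (subst (_≤ D) (shifted a (+ w)) below)
      where
        shifted : ∀ a w → + 1 + (a + (a + (+ 1 + w))) ≡ a + + 1 + (a + + 1 + w)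
        shifted = solve-∀
    regroup : ∀ a w → a + + 1 + w ≡ a + (+ 1 + w)
    regroup = solve-∀

SymUnimodal-window : ∀ {D L f} x → SymUnimodal D L f → SymUnimodal (D + + x) L (window (suc x) f)
SymUnimodal-window {D} {f = f} x S = record
  { symmetric   = λ i → trans (sym (window-symmetric {D} (symmetric S) (suc x) i))
                              (cong (window (suc x) f) (recentre D (+ x) i))
  ; nonnegative = window-nonnegative (nonnegative S) (suc x)
  ; ascending   = ascends
  ; vanishing   = window-vanishing (vanishing S) (suc x)
  }
  where
    recentre : ∀ D x i → D + (+ 1 + x) - + 1 - i ≡ D + x - i
    recentre = solve-∀
    ascends : ∀ i → i + i + + 1 ≤ D + + x → window (suc x) f i ≤ window (suc x) f (i + + 1)
    ascends i h = begin
      window x f i + f (i - + x)                 ≤⟨ +-monoʳ-≤ (window x f i) oldest≤newest ⟩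
      window x f i + f (i + + 1)                 ≡⟨ +-comm (window x f i) (f (i + + 1)) ⟩
      f (i + + 1) + window x f i                 ≡⟨ cong (λ j → f (i + + 1) + window x f j) (cancel i) ⟨
      f (i + + 1) + window x f (i + + 1 - + 1)   ≡⟨ window-unfoldˡ x f (i + + 1) ⟨
      window (suc x) f (i + + 1)                 ∎
      where
        open ≤-Reasoning
        cancel : ∀ i → i + + 1 - + 1 ≡ i
        cancel = solve-∀
        span : ∀ x i → i + i + + 1 - x ≡ i - x + (i - x + (+ 1 + x))
        span = solve-∀
        reach : ∀ x i → i - x + (+ 1 + x) ≡ i + + 1
        reach = solve-∀
        oldest≤newest : f (i - + x) ≤ f (i + + 1)
        oldest≤newest = subst (f (i - + x) ≤_) (cong f (reach (+ x) i))
          (SymUnimodal-ascending-by S (suc x) (i - + x)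
            (subst₂ _≤_ (span (+ x) i) (+-cancel D (+ x)) (+-monoˡ-≤ (- + x) h)))
          where
            +-cancel : ∀ D x → D + x - x ≡ D
            +-cancel = solve-∀

⌊n/2⌋+⌊n/2⌋≤n : ∀ n → ⌊ n /2⌋ ℕ.+ ⌊ n /2⌋ ℕ.≤ n
⌊n/2⌋+⌊n/2⌋≤n n = ℕ.≤-trans (ℕ.+-monoʳ-≤ ⌊ n /2⌋ (ℕ.⌊n/2⌋≤⌈n/2⌉ n)) (ℕ.≤-reflexive (ℕ.⌊n/2⌋+⌈n/2⌉≡n n))

n≤1+⌊n/2⌋+⌊n/2⌋ : ∀ n → n ℕ.≤ suc (⌊ n /2⌋ ℕ.+ ⌊ n /2⌋)
n≤1+⌊n/2⌋+⌊n/2⌋ n = begin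
  n                            ≡⟨ ℕ.⌊n/2⌋+⌈n/2⌉≡n n ⟨
  ⌊ n /2⌋ ℕ.+ ⌈ n /2⌉          ≤⟨ ℕ.+-monoʳ-≤ ⌊ n /2⌋ (ℕ.⌊n/2⌋-mono (ℕ.n≤1+n (suc n))) ⟩
  ⌊ n /2⌋ ℕ.+ suc ⌊ n /2⌋      ≡⟨ ℕ.+-suc ⌊ n /2⌋ ⌊ n /2⌋ ⟩
  suc (⌊ n /2⌋ ℕ.+ ⌊ n /2⌋)    ∎
  where open ℕ.≤-Reasoning

SymUnimodal⇒Palindromic×Unimodal : ∀ {D f} → SymUnimodal D (+ 0) f → + 0 < f (+ 0) →
  Palindromic f × Unimodal f
SymUnimodal⇒Palindromic×Unimodal {D} {f} S f0>0 =
  inj₂ (d , degree , symmetric S′) , inj₂ (d , degree , ⌊ d /2⌋ , ℕ.⌊n/2⌋≤n d , rising , falling)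
  where
    f0≡fD : f (+ 0) ≡ f D
    f0≡fD = trans (symmetric S (+ 0)) (cong f (+-identityʳ D))
    D≥0 : + 0 ≤ D
    D≥0 = ≮⇒≥ (λ D<0 → <-irrefl (sym (trans f0≡fD (vanishing S D D<0))) f0>0)
    d = ℤ.∣ D ∣
    S′ : SymUnimodal (+ d) (+ 0) f
    S′ = subst (λ D → SymUnimodal D (+ 0) f) (sym (0≤i⇒+∣i∣≡i D≥0)) S
    degree : IsPolyOfDegree f d
    degree = (λ fd≡0 → <-irrefl (sym (trans (trans (symmetric S′ (+ 0)) (cong f (+-identityʳ (+ d)))) fd≡0)) f0>0)
           , λ { i (inj₁ i<0) → vanishing S′ i i<0
               ; i (inj₂ d<i) → trans (symmetric S′ i)
                   (vanishing S′ (+ d - i) (subst (+ d - i <_) (+-inverseʳ i) (+-monoˡ-< (- i) d<i))) }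
    rising : ∀ i → i ℕ.< ⌊ d /2⌋ → f (+ i) ≤ f (+ suc i)
    rising i i<m = subst (f (+ i) ≤_) (cong (λ k → f (+ k)) (ℕ.+-comm i 1)) (ascending S′ (+ i) (+≤+ below))
      where
        below : i ℕ.+ i ℕ.+ 1 ℕ.≤ d
        below = begin
          i ℕ.+ i ℕ.+ 1            ≡⟨ ℕ.+-comm (i ℕ.+ i) 1 ⟩
          suc i ℕ.+ i              ≤⟨ ℕ.+-mono-≤ i<m (ℕ.<⇒≤ i<m) ⟩
          ⌊ d /2⌋ ℕ.+ ⌊ d /2⌋      ≤⟨ ⌊n/2⌋+⌊n/2⌋≤n d ⟩
          d                        ∎
          where open ℕ.≤-Reasoning
    falling : ∀ i → ⌊ d /2⌋ ℕ.≤ i → i ℕ.< d → f (+ suc i) ≤ f (+ i)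
    falling i m≤i _ = subst₂ _≤_ (sym (symmetric S′ (+ suc i)))
                                (trans (cong f (step (+ d) (+ i))) (sym (symmetric S′ (+ i))))
                                (ascending S′ j past-centre)
      where
        j = + d - + suc i
        step : ∀ d i → d - (+ 1 + i) + + 1 ≡ d - i
        step = solve-∀
        split : ∀ d i → d + (d - (+ 1 + i + i)) ≡ d - (+ 1 + i) + (d - (+ 1 + i)) + + 1
        split = solve-∀
        past-centre : j + j + + 1 ≤ + d
        past-centre = subst₂ _≤_ (split (+ d) (+ i)) (+-identityʳ (+ d))
          (+-monoʳ-≤ (+ d) (i≤j⇒i-j≤0 (+≤+ (ℕ.≤-trans (n≤1+⌊n/2⌋+⌊n/2⌋ d) (ℕ.s≤s (ℕ.+-mono-≤ m≤i m≤i))))))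

-- The terms of 𝓔 for a single row

factor : ℕ × ℤ → ℕ → LPoly
factor (ℓ , c) m = mono (- + ℓ) (+ 1) ⊗ qint (+ ℓ + + 1 - + m + c)

termSum : ℕ → ℕ → List (ℕ × ℤ) → ℤ → ℤ
termSum m k cells = coeff (concatMap (termProd m) (choose k cells))

termSum-zero : ∀ m cells → termSum m 0 cells ≗ δ
termSum-zero m cells i =
  trans (coeff≗⋆δ (mono (+ 0) (+ 1) ++ []) i) (trans (+-identityʳ _) (trans (*-identityˡ _) (cong δ (+-identityʳ i))))

coeff-concatMap-∷ : ∀ m x Ss →
  coeff (concatMap (termProd m) (map (x ∷_) Ss)) ≗ factor x m ⋆ coeff (concatMap (termProd (suc m)) Ss)
coeff-concatMap-∷ m x [] i = sym (⋆-zero (factor x m) i)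
coeff-concatMap-∷ m x (S ∷ Ss) i = begin
  coeff (termProd m (x ∷ S) ++ rest m (map (x ∷_) Ss)) i
    ≡⟨ coeff-++ (termProd m (x ∷ S)) _ i ⟩
  coeff (factor x m ⊗ termProd (suc m) S) i + coeff (rest m (map (x ∷_) Ss)) i
    ≡⟨ cong₂ _+_ (coeff-⊗ (factor x m) (termProd (suc m) S) i) (coeff-concatMap-∷ m x Ss i) ⟩
  (factor x m ⋆ coeff (termProd (suc m) S)) i + (factor x m ⋆ coeff (rest (suc m) Ss)) i
    ≡⟨ ⋆-+ (factor x m) (coeff (termProd (suc m) S)) (coeff (rest (suc m) Ss)) i ⟨
  (factor x m ⋆ (λ j → coeff (termProd (suc m) S) j + coeff (rest (suc m) Ss) j)) i
    ≡⟨ ⋆-cong (factor x m) (λ j → sym (coeff-++ (termProd (suc m) S) (rest (suc m) Ss) j)) i ⟩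
  (factor x m ⋆ coeff (termProd (suc m) S ++ rest (suc m) Ss)) i ∎
  where
    open ≡-Reasoning
    rest : ℕ → List (List (ℕ × ℤ)) → LPoly
    rest m = concatMap (termProd m)

termSum-∷ : ∀ m k x cells →
  termSum m (suc k) (x ∷ cells) ≗ λ i → (factor x m ⋆ termSum (suc m) k cells) i + termSum m (suc k) cells i
termSum-∷ m k x cells i = begin
  coeff (concatMap (termProd m) (map (x ∷_) (choose k cells) ++ choose (suc k) cells)) i
    ≡⟨ cong (λ p → coeff p i) (concatMap-++ (termProd m) (map (x ∷_) (choose k cells)) (choose (suc k) cells)) ⟩
  coeff (concatMap (termProd m) (map (x ∷_) (choose k cells)) ++ concatMap (termProd m) (choose (suc k) cells)) i
    ≡⟨ coeff-++ (concatMap (termProd m) (map (x ∷_) (choose k cells))) _ i ⟩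
  coeff (concatMap (termProd m) (map (x ∷_) (choose k cells))) i + termSum m (suc k) cells i
    ≡⟨ cong (_+ termSum m (suc k) cells i) (coeff-concatMap-∷ m x (choose k cells) i) ⟩
  (factor x m ⋆ termSum (suc m) k cells) i + termSum m (suc k) cells i ∎
  where open ≡-Reasoning

choose-length< : ∀ {A : Set} k (xs : List A) → length xs ℕ.< k → choose k xs ≡ []
choose-length< (suc k) []       _                 = refl
choose-length< (suc k) (x ∷ xs) (ℕ.s≤s |xs|<k)
  rewrite choose-length< k xs |xs|<k | choose-length< (suc k) xs (ℕ.m≤n⇒m≤1+n |xs|<k) = refl

factor-⋆ : ∀ ℓ c m X g → + ℓ + + 1 - + m + c ≡ + suc X → factor (ℓ , c) m ⋆ g ≗ λ i → window (suc X) g (i - - + ℓ)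
factor-⋆ ℓ c m X g size i = begin
  (factor (ℓ , c) m ⋆ g) i                                 ≡⟨ ⊗-⋆ (mono (- + ℓ) (+ 1)) (qint N) g i ⟩
  (mono (- + ℓ) (+ 1) ⋆ (qint (+ ℓ + + 1 - + m + c) ⋆ g)) i  ≡⟨ trans (mono-⋆ (- + ℓ) (+ 1) (qint N ⋆ g) i) (*-identityˡ _) ⟩
  (qint (+ ℓ + + 1 - + m + c) ⋆ g) (i - - + ℓ)             ≡⟨ cong (λ N → (qint N ⋆ g) (i - - + ℓ)) size ⟩
  (qint (+ suc X) ⋆ g) (i - - + ℓ)                         ≡⟨ qint-⋆ (suc X) g (i - - + ℓ) ⟩
  window (suc X) g (i - - + ℓ)                             ∎
  where
    open ≡-Reasoning
    N = + ℓ + + 1 - + m + c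

factor-SymUnimodal : ∀ {D L g} ℓ c m X → + ℓ + + 1 - + m + c ≡ + suc X →
  SymUnimodal D L g × + 0 < g L →
  SymUnimodal (D + + X + - + ℓ + - + ℓ) (L + - + ℓ) (factor (ℓ , c) m ⋆ g) × + 0 < (factor (ℓ , c) m ⋆ g) (L + - + ℓ)
factor-SymUnimodal {L = L} {g} ℓ c m X size (S , gL>0) =
  SymUnimodal-resp (λ i → sym (factor-⋆ ℓ c m X g size i)) (SymUnimodal-shift (- + ℓ) (SymUnimodal-window X S)) ,
  <-≤-trans gL>0 (subst₂ _≤_ (cong g (cancel L (+ ℓ))) (sym (factor-⋆ ℓ c m X g size (L + - + ℓ)))
                    (≤-window (nonnegative S) X (L + - + ℓ - - + ℓ)))
  where
    cancel : ∀ L ℓ → L + - ℓ - - ℓ ≡ L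
    cancel = solve-∀

run : ℤ → ℕ → ℕ → List (ℕ × ℤ)
run κ ℓ zero      = []
run κ ℓ (suc len) = (ℓ , + ℓ + κ) ∷ run κ (suc ℓ) len

length-run : ∀ κ ℓ len → length (run κ ℓ len) ≡ len
length-run κ ℓ zero      = refl
length-run κ ℓ (suc len) = cong suc (length-run κ (suc ℓ) len)

-- The factor for cell (ℓ , ℓ + κ) at position m spans the exponents -ℓ … ℓ + κ - m,
-- whose sum κ - m does not depend on ℓ.
doubleCentre : ℤ → ℕ → ℕ → ℤ
doubleCentre κ m zero    = + 0
doubleCentre κ m (suc k) = κ - + m + doubleCentre κ (suc m) k

-- Minus the sum of the k largest labels below E.
lowest : ℕ → ℕ → ℤ
lowest zero    E = + 0
lowest (suc k) E = lowest k E - (+ E - + suc k)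

lowest-suc : ∀ k ℓ v {E} → ℓ ℕ.+ suc (k ℕ.+ v) ≡ E → lowest (suc k) E + + v ≡ lowest k E + - + ℓ
lowest-suc k ℓ v refl = begin
  L - (+ (ℓ ℕ.+ suc (k ℕ.+ v)) - + suc k) + + v    ≡⟨ cong (λ E → L - (E - + suc k) + + v) (pos-+ ℓ (suc (k ℕ.+ v))) ⟩
  L - (+ ℓ + + suc (k ℕ.+ v) - + suc k) + + v      ≡⟨ cong (λ E → L - (+ ℓ + (+ 1 + E) - (+ 1 + + k)) + + v) (pos-+ k v) ⟩
  L - (+ ℓ + (+ 1 + (+ k + + v)) - (+ 1 + + k)) + + v  ≡⟨ cancel L (+ ℓ) (+ k) (+ v) ⟩
  L + - + ℓ                                       ∎
  where
    open ≡-Reasoning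
    L = lowest k (ℓ ℕ.+ suc (k ℕ.+ v))
    cancel : ∀ L ℓ k v → L - (ℓ + (+ 1 + (k + v)) - (+ 1 + k)) + v ≡ L + - ℓ
    cancel = solve-∀

first-cell-SymUnimodal : ∀ ℓ m X {D L g} → SymUnimodal D L g × + 0 < g L →
  let κ = + m + + X - + ℓ - + ℓ in
  SymUnimodal (κ - + m + D) (L + - + ℓ) (factor (ℓ , + ℓ + κ) m ⋆ g) × + 0 < (factor (ℓ , + ℓ + κ) m ⋆ g) (L + - + ℓ)
first-cell-SymUnimodal ℓ m X {D} {L} {g} IH =
  Product.map₁ (subst (λ D → SymUnimodal D (L + - + ℓ) _) (centre D (+ ℓ) (+ m) (+ X)))
    (factor-SymUnimodal ℓ _ m X (size (+ ℓ) (+ m) (+ X)) IH)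
  where
    size : ∀ ℓ m X → ℓ + + 1 - m + (ℓ + (m + X - ℓ - ℓ)) ≡ + 1 + X
    size = solve-∀
    centre : ∀ D ℓ m X → D + X + - ℓ + - ℓ ≡ m + X - ℓ - ℓ - m + D
    centre = solve-∀

-- X + 1 is the size of the q-integer contributed by the first cell at position m.
run-SymUnimodal : ∀ {κ} len k ℓ m X {E} → κ ≡ + m + + X - + ℓ - + ℓ → ℓ ℕ.+ len ≡ E → k ℕ.≤ len →
  SymUnimodal (doubleCentre κ m k) (lowest k E) (termSum m k (run κ ℓ len)) ×
  + 0 < termSum m k (run κ ℓ len) (lowest k E)
run-SymUnimodal {κ} len zero ℓ m X _ _ _ =
  SymUnimodal-resp (λ i → sym (termSum-zero m (run κ ℓ len) i)) SymUnimodal-δ ,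
  subst (+ 0 <_) (sym (termSum-zero m (run κ ℓ len) (+ 0))) (+<+ (ℕ.s≤s ℕ.z≤n))
run-SymUnimodal (suc len) (suc k) ℓ m X refl refl (ℕ.s≤s k≤len) =
  let v , k+v≡len = ℕ.m≤n⇒∃[o]m+o≡n k≤len in
  Product.map (SymUnimodal-resp (λ i → sym (termSum-∷ m k cell rest i)))
              (subst (+ 0 <_) (sym (termSum-∷ m k cell rest L)))
              (take+skip v k+v≡len)
  where
    κ = + m + + X - + ℓ - + ℓ
    cell = (ℓ , + ℓ + κ)
    rest = run κ (suc ℓ) len
    E = ℓ ℕ.+ suc len
    L = lowest (suc k) E
    D = doubleCentre κ m (suc k)
    take skip : ℤ → ℤ
    take = factor cell m ⋆ termSum (suc m) k rest
    skip = termSum m (suc k) rest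
    take-slack : ∀ ℓ m X → m + X - ℓ - ℓ ≡ + 1 + m + (+ 1 + X) - (+ 1 + ℓ) - (+ 1 + ℓ)
    take-slack = solve-∀
    skip-slack : ∀ ℓ m X → m + X - ℓ - ℓ ≡ m + (+ 2 + X) - (+ 1 + ℓ) - (+ 1 + ℓ)
    skip-slack = solve-∀
    take-SU : SymUnimodal D (lowest k E + - + ℓ) take × + 0 < take (lowest k E + - + ℓ)
    take-SU = first-cell-SymUnimodal ℓ m X
      (run-SymUnimodal len k (suc ℓ) (suc m) (suc X) (take-slack (+ ℓ) (+ m) (+ X)) (sym (ℕ.+-suc ℓ len)) k≤len)
    take+skip : ∀ v → k ℕ.+ v ≡ len → SymUnimodal D L (λ i → take i + skip i) × + 0 < take L + skip L
    take+skip zero k+0≡len =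
      SymUnimodal-resp (λ i → sym (take+skip≡take i)) (subst (λ L → SymUnimodal D L take) (sym L≡) (proj₁ take-SU)) ,
      subst (+ 0 <_) (sym (trans (take+skip≡take L) (cong take L≡))) (proj₂ take-SU)
      where
        L≡ : L ≡ lowest k E + - + ℓ
        L≡ = trans (sym (+-identityʳ L)) (lowest-suc k ℓ 0 (cong (λ n → ℓ ℕ.+ suc n) k+0≡len))
        no-skip : choose (suc k) rest ≡ []
        no-skip = choose-length< (suc k) rest (subst (ℕ._< suc k) (sym |rest|≡k) (ℕ.n<1+n k))
          where
            |rest|≡k : length rest ≡ k
            |rest|≡k = trans (length-run κ (suc ℓ) len) (trans (sym k+0≡len) (ℕ.+-identityʳ k))
        take+skip≡take : ∀ i → take i + skip i ≡ take i
        take+skip≡take i = trans (cong (λ Ss → take i + coeff (concatMap (termProd m) Ss) i) no-skip) (+-identityʳ (take i))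
    take+skip (suc v) k+v≡len =
      SymUnimodal-+-positive (SymUnimodal-weaken L≤ (proj₁ take-SU))
        (run-SymUnimodal len (suc k) (suc ℓ) m (suc (suc X)) (skip-slack (+ ℓ) (+ m) (+ X)) (sym (ℕ.+-suc ℓ len))
          (ℕ.≤-trans (ℕ.m≤m+n (suc k) v) (ℕ.≤-reflexive (trans (sym (ℕ.+-suc k v)) k+v≡len))))
      where
        L≤ : L ≤ lowest k E + - + ℓ
        L≤ = subst (L ≤_) (lowest-suc k ℓ (suc v) (cong (λ n → ℓ ℕ.+ suc n) k+v≡len)) (i≤i+j L (+ suc v))

lowest+shift≡0 : ∀ n k → lowest k (suc n) + (+ (n ℕ.* k) - + (k C 2)) ≡ + 0
lowest+shift≡0 n zero    = cong (λ z → + z - + 0) (ℕ.*-zeroʳ n)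
lowest+shift≡0 n (suc k) = begin
  L - (+ suc n - + suc k) + (+ (n ℕ.* suc k) - + (suc k C 2))
    ≡⟨ cong₂ (λ a b → L - (+ suc n - + suc k) + (+ a - + b)) (ℕ.*-suc n k) (sym suc-k-C-2) ⟩
  L - (+ suc n - + suc k) + (+ (n ℕ.+ n ℕ.* k) - + (k ℕ.+ k C 2))
    ≡⟨ cong₂ (λ a b → L - (+ suc n - + suc k) + (a - b)) (pos-+ n (n ℕ.* k)) (pos-+ k (k C 2)) ⟩
  L - (+ 1 + + n - (+ 1 + + k)) + (+ n + + (n ℕ.* k) - (+ k + + (k C 2)))
    ≡⟨ regroup L (+ n) (+ k) (+ (n ℕ.* k)) (+ (k C 2)) ⟩
  L + (+ (n ℕ.* k) - + (k C 2))
    ≡⟨ lowest+shift≡0 n k ⟩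
  + 0 ∎
  where
    open ≡-Reasoning
    L = lowest k (suc n)
    suc-k-C-2 : k ℕ.+ k C 2 ≡ suc k C 2
    suc-k-C-2 = trans (cong (ℕ._+ k C 2) (sym (nC1≡n k))) (nCk+nC[k+1]≡[n+1]C[k+1] k 1)
    regroup : ∀ L n k nk c → L - (+ 1 + n - (+ 1 + k)) + (n + nk - (k + c)) ≡ L + (nk - c)
    regroup = solve-∀

𝓔ᶜ : ℕ → ℕ → List (ℕ × ℤ) → LPoly
𝓔ᶜ n k cells = mono (+ (n ℕ.* k) - + (k C 2)) (+ 1) ⊗ concatMap (termProd 1) (choose k cells)

coeff-𝓔ᶜ : ∀ n k cells → coeff (𝓔ᶜ n k cells) ≗ λ i → termSum 1 k cells (i - (+ (n ℕ.* k) - + (k C 2)))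
coeff-𝓔ᶜ n k cells i = trans (coeff-⊗ (mono shift (+ 1)) terms i) (trans (mono-⋆ shift (+ 1) (coeff terms) i) (*-identityˡ _))
  where
    shift = + (n ℕ.* k) - + (k C 2)
    terms = concatMap (termProd 1) (choose k cells)

run-Palindromic×Unimodal : ∀ {κ} j s k X → κ ≡ + 1 + + X - + suc j - + suc j →
  Palindromic (coeff (𝓔ᶜ (j ℕ.+ s) k (run κ (suc j) s))) × Unimodal (coeff (𝓔ᶜ (j ℕ.+ s) k (run κ (suc j) s)))
run-Palindromic×Unimodal {κ} j s k X κ≡ with k ℕ.≤? s
... | no  k≰s rewrite choose-length< k (run κ (suc j) s) (subst (ℕ._< k) (sym (length-run κ (suc j) s)) (ℕ.≰⇒> k≰s)) =
  inj₁ (λ _ → refl) , inj₁ (λ _ → refl)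
... | yes k≤s = SymUnimodal⇒Palindromic×Unimodal
  (SymUnimodal-resp (λ i → sym (coeff-𝓔ᶜ n k cells i))
    (subst (λ L → SymUnimodal (doubleCentre κ 1 k + shift + shift) L (λ i → termSum 1 k cells (i - shift))) (lowest+shift≡0 n k) (SymUnimodal-shift shift (proj₁ S))))
  (subst (+ 0 <_) (sym (trans (coeff-𝓔ᶜ n k cells (+ 0)) (cong (termSum 1 k cells) 0-shift≡lowest))) (proj₂ S))
  where
    n = j ℕ.+ s
    cells = run κ (suc j) s
    shift = + (n ℕ.* k) - + (k C 2)
    S = run-SymUnimodal s k (suc j) 1 X κ≡ refl k≤s
    0-shift≡lowest : + 0 - shift ≡ lowest k (suc n)
    0-shift≡lowest = trans (cong (_- shift) (sym (lowest+shift≡0 n k))) (cancel (lowest k (suc n)) shift)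
      where
        cancel : ∀ L e → L + e - e ≡ L
        cancel = solve-∀

label-applyUpTo : ∀ κ ℓ (φ : ℕ → ℤ) len → (∀ t → φ t ≡ + (t ℕ.+ ℓ) + κ) → label ℓ (applyUpTo φ len) ≡ run κ ℓ len
label-applyUpTo κ ℓ φ zero      φ≡ = refl
label-applyUpTo κ ℓ φ (suc len) φ≡ = cong₂ _∷_ (cong (ℓ ,_) (φ≡ 0))
  (label-applyUpTo κ (suc ℓ) (φ ∘ suc) len (λ t → trans (φ≡ (suc t)) (cong (λ n → + n + κ) (sym (ℕ.+-suc t ℓ)))))

label-rowContents : ∀ j r a b → label (suc j) (rowContents r a b) ≡ run (+ a - + r - + suc j) (suc j) (b ∸ a)
label-rowContents j r a b = trans (cong (label (suc j)) (map-upTo content (b ∸ a))) (label-applyUpTo _ (suc j) content (b ∸ a) content≡)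
  where
    content : ℕ → ℤ
    content t = + (a ℕ.+ t) - + r
    regroup : ∀ a t r j → a + t - r ≡ t + (+ 1 + j) + (a - r - (+ 1 + j))
    regroup = solve-∀
    content≡ : ∀ t → content t ≡ + (t ℕ.+ suc j) + (+ a - + r - + suc j)
    content≡ t = begin
      + (a ℕ.+ t) - + r                                ≡⟨ cong (_- + r) (pos-+ a t) ⟩
      + a + + t - + r                                  ≡⟨ regroup (+ a) (+ t) (+ r) (+ j) ⟩
      + t + + suc j + (+ a - + r - + suc j)            ≡⟨ cong (_+ (+ a - + r - + suc j)) (pos-+ t (suc j)) ⟨
      + (t ℕ.+ suc j) + (+ a - + r - + suc j)          ∎
      where open ≡-Reasoning

row-Palindromic×Unimodal : ∀ j r a b k → (0 ℕ.< b ∸ a → r ℕ.≤ j) →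
  Palindromic (coeff (𝓔ᶜ (j ℕ.+ (b ∸ a)) k (label (suc j) (rowContents r a b)))) ×
  Unimodal (coeff (𝓔ᶜ (j ℕ.+ (b ∸ a)) k (label (suc j) (rowContents r a b))))
row-Palindromic×Unimodal j r a b k r≤j rewrite label-rowContents j r a b with b ∸ a
-- Without cells κ is irrelevant, so pick one with slack 0.
... | zero  = run-Palindromic×Unimodal {+ 1 + + 0 - + suc j - + suc j} j 0 k 0 refl
... | suc s = let o , r+o≡j = ℕ.m≤n⇒∃[o]m+o≡n (r≤j (ℕ.s≤s ℕ.z≤n)) in
  run-Palindromic×Unimodal j (suc s) k (o ℕ.+ a) (slack o r+o≡j)
  where
    regroup : ∀ a r o → a - r - (+ 1 + (r + o)) ≡ + 1 + (o + a) - (+ 1 + (r + o)) - (+ 1 + (r + o))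
    regroup = solve-∀
    slack : ∀ o → r ℕ.+ o ≡ j → + a - + r - + suc j ≡ + 1 + + (o ℕ.+ a) - + suc j - + suc j
    slack o refl = begin
      + a - + r - (+ 1 + + (r ℕ.+ o))                                          ≡⟨ cong (λ z → + a - + r - (+ 1 + z)) (pos-+ r o) ⟩
      + a - + r - (+ 1 + (+ r + + o))                                          ≡⟨ regroup (+ a) (+ r) (+ o) ⟩
      + 1 + (+ o + + a) - (+ 1 + (+ r + + o)) - (+ 1 + (+ r + + o))            ≡⟨ cong₂ (λ x y → + 1 + x - (+ 1 + y) - (+ 1 + y)) (pos-+ o a) (pos-+ r o) ⟨
      + 1 + + (o ℕ.+ a) - + suc (r ℕ.+ o) - + suc (r ℕ.+ o)                    ∎
      where open ≡-Reasoning

-- Skew shapes with a single row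

part-drop1 : ∀ xs i → part (drop 1 xs) i ≡ part xs (suc i)
part-drop1 []      i = refl
part-drop1 (_ ∷ _) i = refl

sum-drop1 : ∀ xs → sum xs ≡ part xs 0 ℕ.+ sum (drop 1 xs)
sum-drop1 []      = refl
sum-drop1 (_ ∷ _) = refl

sum-cong : ∀ xs ys → (∀ i → part xs i ≡ part ys i) → sum xs ≡ sum ys
sum-cong []       []       _  = refl
sum-cong []       (y ∷ ys) xs≡ys = cong₂ ℕ._+_ (xs≡ys 0) (sum-cong [] ys (xs≡ys ∘ suc))
sum-cong (x ∷ xs) []       xs≡ys = cong₂ ℕ._+_ (xs≡ys 0) (sum-cong xs [] (xs≡ys ∘ suc))
sum-cong (x ∷ xs) (y ∷ ys) xs≡ys = cong₂ ℕ._+_ (xs≡ys 0) (sum-cong xs ys (xs≡ys ∘ suc))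

sum-singleRow : ∀ R λ′ μ → (∀ i → i ≢ R → part μ i ≡ part λ′ i) → part μ R ℕ.≤ part λ′ R →
  sum λ′ ≡ sum μ ℕ.+ (part λ′ R ∸ part μ R)
sum-singleRow zero λ′ μ outside μ≤λ = begin
  sum λ′                                            ≡⟨ sum-drop1 λ′ ⟩
  part λ′ 0 ℕ.+ sum (drop 1 λ′)                     ≡⟨ cong₂ ℕ._+_ (sym (ℕ.m+[n∸m]≡n μ≤λ)) (sum-cong (drop 1 λ′) (drop 1 μ) tails) ⟩
  part μ 0 ℕ.+ (part λ′ 0 ∸ part μ 0) ℕ.+ sum (drop 1 μ)  ≡⟨ ℕ-+.xy∙z≈xz∙y (part μ 0) _ _ ⟩
  part μ 0 ℕ.+ sum (drop 1 μ) ℕ.+ (part λ′ 0 ∸ part μ 0)  ≡⟨ cong (ℕ._+ (part λ′ 0 ∸ part μ 0)) (sum-drop1 μ) ⟨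
  sum μ ℕ.+ (part λ′ 0 ∸ part μ 0)                  ∎
  where
    open ≡-Reasoning
    tails : ∀ i → part (drop 1 λ′) i ≡ part (drop 1 μ) i
    tails i = trans (part-drop1 λ′ i) (trans (sym (outside (suc i) λ ())) (sym (part-drop1 μ i)))
sum-singleRow (suc R) λ′ μ outside μ≤λ = begin
  sum λ′                                            ≡⟨ sum-drop1 λ′ ⟩
  part λ′ 0 ℕ.+ sum (drop 1 λ′)                     ≡⟨ cong₂ ℕ._+_ (sym (outside 0 λ ())) tails ⟩
  part μ 0 ℕ.+ (sum (drop 1 μ) ℕ.+ (part λ′ (suc R) ∸ part μ (suc R)))  ≡⟨ ℕ.+-assoc (part μ 0) _ _ ⟨
  part μ 0 ℕ.+ sum (drop 1 μ) ℕ.+ (part λ′ (suc R) ∸ part μ (suc R))    ≡⟨ cong (ℕ._+ (part λ′ (suc R) ∸ part μ (suc R))) (sum-drop1 μ) ⟨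
  sum μ ℕ.+ (part λ′ (suc R) ∸ part μ (suc R))      ∎
  where
    open ≡-Reasoning
    tails : sum (drop 1 λ′) ≡ sum (drop 1 μ) ℕ.+ (part λ′ (suc R) ∸ part μ (suc R))
    tails = subst₂ (λ a b → sum (drop 1 λ′) ≡ sum (drop 1 μ) ℕ.+ (a ∸ b)) (part-drop1 λ′ R) (part-drop1 μ R)
      (sum-singleRow R (drop 1 λ′) (drop 1 μ)
        (λ i i≢R → trans (part-drop1 μ i) (trans (outside (suc i) (i≢R ∘ ℕ.suc-injective)) (sym (part-drop1 λ′ i))))
        (subst₂ ℕ._≤_ (sym (part-drop1 μ R)) (sym (part-drop1 λ′ R)) μ≤λ))

rowContents-empty : ∀ r a b → b ℕ.≤ a → rowContents r a b ≡ []
rowContents-empty r a b b≤a rewrite ℕ.m≤n⇒m∸n≡0 b≤a = refl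

skewContentsFrom-∷ : ∀ r l ls μ → skewContentsFrom r (l ∷ ls) μ ≡ rowContents r (part μ 0) l ++ skewContentsFrom (suc r) ls (drop 1 μ)
skewContentsFrom-∷ r l ls []      = refl
skewContentsFrom-∷ r l ls (_ ∷ _) = refl

skewContentsFrom-empty : ∀ r λ′ μ → (∀ i → part μ i ≡ part λ′ i) → skewContentsFrom r λ′ μ ≡ []
skewContentsFrom-empty r []       μ μ≡λ = refl
skewContentsFrom-empty r (l ∷ ls) μ μ≡λ
  rewrite skewContentsFrom-∷ r l ls μ | rowContents-empty r (part μ 0) l (ℕ.≤-reflexive (sym (μ≡λ 0))) =
  skewContentsFrom-empty (suc r) ls (drop 1 μ) (λ i → trans (part-drop1 μ i) (μ≡λ (suc i)))

skewContentsFrom-singleRow : ∀ R r λ′ μ → (∀ i → i ≢ R → part μ i ≡ part λ′ i) →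
  skewContentsFrom r λ′ μ ≡ rowContents (r ℕ.+ R) (part μ R) (part λ′ R)
skewContentsFrom-singleRow R r [] μ _ = sym (rowContents-empty (r ℕ.+ R) (part μ R) 0 ℕ.z≤n)
skewContentsFrom-singleRow zero r (l ∷ ls) μ outside
  rewrite skewContentsFrom-∷ r l ls μ
        | skewContentsFrom-empty (suc r) ls (drop 1 μ) (λ i → trans (part-drop1 μ i) (outside (suc i) λ ()))
        | ℕ.+-identityʳ r = ++-identityʳ _
skewContentsFrom-singleRow (suc R) r (l ∷ ls) μ outside
  rewrite skewContentsFrom-∷ r l ls μ | rowContents-empty r (part μ 0) l (ℕ.≤-reflexive (sym (outside 0 λ ())))
        | ℕ.+-suc r R | sym (part-drop1 μ R) =
  skewContentsFrom-singleRow R (suc r) ls (drop 1 μ)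
    (λ i i≢R → trans (part-drop1 μ i) (outside (suc i) (i≢R ∘ ℕ.suc-injective)))

part-antitone : ∀ {xs} → Linked ℕ._≥_ xs → ∀ {i j} → i ℕ.≤ j → part xs j ℕ.≤ part xs i
part-antitone Linked.[]                                  _           = ℕ.z≤n
part-antitone Linked.[-]                   {j = zero}    ℕ.z≤n       = ℕ.≤-refl
part-antitone Linked.[-]                   {j = suc j}   _           = ℕ.z≤n
part-antitone (x≥y Linked.∷ _)             {j = zero}    ℕ.z≤n       = ℕ.≤-refl
part-antitone (x≥y Linked.∷ ys↓)           {j = suc j}   ℕ.z≤n       = ℕ.≤-trans (part-antitone ys↓ {0} {j} ℕ.z≤n) x≥y
part-antitone (_ Linked.∷ ys↓)                           (ℕ.s≤s i≤j) = part-antitone ys↓ i≤j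

≤-sum : ∀ R xs → (∀ i → i ℕ.< R → 1 ℕ.≤ part xs i) → R ℕ.≤ sum xs
≤-sum zero    xs       _       = ℕ.z≤n
≤-sum (suc R) []       rows≥1 with rows≥1 0 (ℕ.s≤s ℕ.z≤n)
... | ()
≤-sum (suc R) (x ∷ xs) rows≥1 = ℕ.+-mono-≤ (rows≥1 0 (ℕ.s≤s ℕ.z≤n)) (≤-sum R xs (λ i i<R → rows≥1 (suc i) (ℕ.s≤s i<R)))

proposition5p27 : (n : ℕ) (λ′ μ : List ℕ) → IsPartition λ′ → sum λ′ ≡ n →
    IsPartition μ → μ ⊆ₚ λ′ → HorizontalStrip λ′ μ → SingleRow λ′ μ →
    (k : ℕ) →
    Palindromic (coeff (𝓔 λ′ μ k)) × Unimodal (coeff (𝓔 λ′ μ k))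
proposition5p27 _ λ′ μ (_ , λ′↓) _ _ μ⊆λ′ _ (R , outside) k =
  subst (λ P → Palindromic (coeff P) × Unimodal (coeff P)) (sym 𝓔≡)
    (row-Palindromic×Unimodal (sum μ) R (part μ R) (part λ′ R) k R≤|μ|)
  where
    𝓔≡ : 𝓔 λ′ μ k ≡ 𝓔ᶜ (sum μ ℕ.+ (part λ′ R ∸ part μ R)) k (label (suc (sum μ)) (rowContents R (part μ R) (part λ′ R)))
    𝓔≡ = cong₂ (λ n cs → 𝓔ᶜ n k (label (suc (sum μ)) cs))
               (sum-singleRow R λ′ μ outside (μ⊆λ′ R)) (skewContentsFrom-singleRow R 0 λ′ μ outside)
    R≤|μ| : 0 ℕ.< part λ′ R ∸ part μ R → R ℕ.≤ sum μ
    R≤|μ| nonempty = ≤-sum R μ λ i i<R →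
      subst (1 ℕ.≤_) (sym (outside i (ℕ.<⇒≢ i<R)))
        (ℕ.≤-trans (ℕ.≤-trans nonempty (ℕ.m∸n≤m (part λ′ R) (part μ R))) (part-antitone λ′↓ (ℕ.<⇒≤ i<R)))
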